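{- Consider the ten typed systems $\Delta^{\rm CD}_{\equiv},\Delta^{\rm CDV}_{\equiv},\Delta^{\rm CDS}_{\equiv},\Delta^{\rm BCD}_{\equiv},\Delta^{\rm CD}_{=_\beta},\Delta^{\rm CDV}_{=_\beta},\Delta^{\rm CDS}_{=_\beta},\Delta^{\rm BCD}_{=_\beta},\Delta^{\rm CDV}_{=_{\beta\eta}},\Delta^{\rm BCD}_{=_{\beta\eta}}$, each compared to the type assignment system $\lambda^{\mathcal T}_\cap$ with the same type theory $\mathcal T$. (a) Completeness holds for all ten systems: if $B\vdash^{\mathcal T}_\cap M:\sigma$, then there is a $\Delta$-term $\Delta$ with $M\equiv\lfloor\Delta\rfloor$ and $B\vdash^{\mathcal T}_{\mathcal R}\Delta:\sigma$. (b) Soundness (if $B\vdash^{\mathcal T}_{\mathcal R}\Delta:\sigma$ then $B\vdash^{\mathcal T}_\cap\lfloor\Delta\rfloor:\sigma$) holds for $\Delta^{\rm CD}_{\equiv},\Delta^{\rm CDV}_{\equiv},\Delta^{\rm CDS}_{\equiv},\Delta^{\rm BCD}_{\equiv},\Delta^{\rm CDS}_{=_\beta},\Delta^{\rm BCD}_{=_\beta}$. (c) Soundness fails for $\Delta^{\rm CD}_{=_\beta},\Delta^{\rm CDV}_{=_\beta},\Delta^{\rm CDV}_{=_{\beta\eta}},\Delta^{\rm BCD}_{=_{\beta\eta}}$: in each of these there exist $B,\Delta,\sigma$ with $B\vdash^{\mathcal T}_{\mathcal R}\Delta:\sigma$ but not $B\vdash^{\mathcal T}_\cap\lfloor\Del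ta\rfloor:\sigma$.
   Context: Types: $\mathbb A_\infty=\{a_i\mid i\in\mathbb N\}$, $\omega$ special atom, $\mathbb A^\omega_\infty=\mathbb A_\infty\cup\{\omega\}$; types $\sigma::=\mathbb A\mid\sigma\to\sigma\mid\sigma\cap\sigma$. Minimal type theory: (refl), (incl) $\sigma\cap\tau\le\sigma,\sigma\cap\tau\le\tau$, (glb) $\rho\le\sigma,\rho\le\tau\Rightarrow\rho\le\sigma\cap\tau$, (trans). Extras: $(\omega_{top})$ $\sigma\le\omega$; $(\omega_\to)$ $\omega\le\sigma\to\omega$; $(\to\cap)$ $(\sigma\to\tau)\cap(\sigma\to\rho)\le\sigma\to\tau\cap\rho$; $(\to)$ $\sigma_2\le\sigma_1,\tau_1\le\tau_2\Rightarrow\sigma_1\to\tau_1\le\sigma_2\to\tau_2$. $\mathcal T_{\rm CD}$ (CD): over $\mathbb A_\infty$, minimal; $\mathcal T_{\rm CDS}$ (CDS): over $\mathbb A^\omega_\infty$ plus $(\omega_{top})$; $\mathcal T_{\rm CDV}$ (CDV): over $\mathbb A_\infty$ plus $(\to),(\to\cap)$; $\mathcal T_{\rm BCD}$ (BCD): over $\mathbb A^\omega_\infty$ plus all four extras. Type assignment $\lambda^{\mathcal T}_\cap$ for pure $\lambda$-terms $M$ ($B$ a basis): (ax) $B\vdash x:\sigma$ if $x{:}\sigma\in B$; ($\to I$) $B,x{:}\sigma\vdash M:\tau\Rightarrow B\vdash\lambda x.M:\sigma\to\tau$; ($\to E$) $M:\sigma\to\tau$, $N:\sigma\Rightarrow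 MN:\tau$; ($\cap I$) $M:\sigma$, $M:\tau\Rightarrow M:\sigma\cap\tau$; ($\cap E$) $M:\sigma\cap\tau\Rightarrow M:\sigma$ and $M:\tau$; (top) $B\vdash M:\omega$ if $\omega$ is an atom of $\mathcal T$; ($\le_{\mathcal T}$) $M:\sigma$, $\sigma\le_{\mathcal T}\tau\Rightarrow M:\tau$. $\Delta$-terms: $\Delta::=u_\Delta\mid x\mid\lambda x{:}\sigma.\Delta\mid\Delta\,\Delta\mid\langle\Delta,\Delta\rangle\mid pr_i\Delta\mid\Delta^\sigma$, $u_\Delta$ a constant indexed by an arbitrary $\Delta$-term. Essence: $\lfloor x\rfloor=x$, $\lfloor u_\Delta\rfloor=\lfloor\Delta\rfloor$, $\lfloor\Delta^\sigma\rfloor=\lfloor\Delta\rfloor$, $\lfloor\lambda x{:}\sigma.\Delta\rfloor=\lambda x.\lfloor\Delta\rfloor$, $\lfloor\Delta_1\Delta_2\rfloor=\lfloor\Delta_1\rfloor\lfloor\Delta_2\rfloor$, $\lfloor\langle\Delta_1,\Delta_2\rangle\rfloor=\lfloor\Delta_1\rfloor$, $\lfloor pr_i\Delta\rfloor=\lfloor\Delta\rfloor$. Typed system $\Delta^{\mathcal T}_{\mathcal R}$ ($\mathcal R\in\{\equiv,=_\beta,=_{\beta\eta}\}$ on pure $\lambda$-terms): (top) $B\vdash u_\Delta:\omega$ if $\omega$ is an atom of $\mathcal T$; (ax); ($\to I$) $B,x{:}\sigma\vdash\Delta:\tau\Rightarrow B\vdash\lambda x{:}\sigma.\Delta:\sigma\to\tau$;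 ($\to E$); ($\cap I$) from $B\vdash\Delta_1:\sigma$, $B\vdash\Delta_2:\tau$, $\lfloor\Delta_1\rfloor\mathcal R\lfloor\Delta_2\rfloor$ get $B\vdash\langle\Delta_1,\Delta_2\rangle:\sigma\cap\tau$; ($\cap E_i$) from $\Delta:\sigma\cap\tau$ get $pr_1\Delta:\sigma$, $pr_2\Delta:\tau$; ($\le_{\mathcal T}$) from $\Delta:\sigma$, $\sigma\le_{\mathcal T}\tau$ get $\Delta^\tau:\tau$. $\Delta^{\rm CD}_{=_\beta}$ denotes $\Delta^{\mathcal T_{\rm CD}}_{=_\beta}$, etc. -}

module Defs where

open import Data.Nat using (ℕ; zero; suc)
open import Data.Bool using (Bool; true; false)
open import Data.Maybe using (Maybe; just; nothing)
open import Data.List using (List; []; _∷_)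
open import Data.Product using (Σ; _×_; _,_)
open import Relation.Binary.PropositionalEquality using (_≡_)
open import Relation.Nullary using (¬_)

-- Types.  Atoms a_i (i ∈ ℕ) and, when the flag is true, the special
-- atom ω.  Type w is the set of types over A_∞ (w = false) or A^ω_∞
-- (w = true).

data Type : Bool → Set where
  atom : ∀ {w} → ℕ → Type w
  ω    : Type true
  _⇒_  : ∀ {w} → Type w → Type w → Type w
  _∩_  : ∀ {w} → Type w → Type w → Type w

infixr 7 _⇒_
infixl 8 _∩_

data Theory : Set where
  CD CDV CDS BCD : Theory

hasω : Theory → Bool
hasω CD  = false
hasω CDV = false
hasω CDS = true
hasω BCD = true

Ty : Theory → Set
Ty T = Type (hasω T)

infix 4 _⊢_≤_
data _⊢_≤_ : (T : Theory) → Ty T → Ty T → Set where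
  refl   : ∀ {T} {σ : Ty T} → T ⊢ σ ≤ σ
  incl₁  : ∀ {T} {σ τ : Ty T} → T ⊢ σ ∩ τ ≤ σ
  incl₂  : ∀ {T} {σ τ : Ty T} → T ⊢ σ ∩ τ ≤ τ
  glb    : ∀ {T} {ρ σ τ : Ty T} → T ⊢ ρ ≤ σ → T ⊢ ρ ≤ τ → T ⊢ ρ ≤ σ ∩ τ
  trans  : ∀ {T} {σ τ ρ : Ty T} → T ⊢ σ ≤ τ → T ⊢ τ ≤ ρ → T ⊢ σ ≤ ρ
  ωtop-CDS : ∀ {σ : Ty CDS} → CDS ⊢ σ ≤ ω
  ωtop-BCD : ∀ {σ : Ty BCD} → BCD ⊢ σ ≤ ω
  ω⇒-BCD   : ∀ {σ : Ty BCD} → BCD ⊢ ω ≤ σ ⇒ ω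
  ⇒∩-CDV   : ∀ {σ τ ρ : Ty CDV} → CDV ⊢ (σ ⇒ τ) ∩ (σ ⇒ ρ) ≤ σ ⇒ (τ ∩ ρ)
  ⇒∩-BCD   : ∀ {σ τ ρ : Ty BCD} → BCD ⊢ (σ ⇒ τ) ∩ (σ ⇒ ρ) ≤ σ ⇒ (τ ∩ ρ)
  arr-CDV  : ∀ {σ₁ σ₂ τ₁ τ₂ : Ty CDV} → CDV ⊢ σ₂ ≤ σ₁ → CDV ⊢ τ₁ ≤ τ₂ →
             CDV ⊢ σ₁ ⇒ τ₁ ≤ σ₂ ⇒ τ₂
  arr-BCD  : ∀ {σ₁ σ₂ τ₁ τ₂ : Ty BCD} → BCD ⊢ σ₂ ≤ σ₁ → BCD ⊢ τ₁ ≤ τ₂ →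
             BCD ⊢ σ₁ ⇒ τ₁ ≤ σ₂ ⇒ τ₂

data HasΩ : Theory → Set where
  CDS-hasΩ : HasΩ CDS
  BCD-hasΩ : HasΩ BCD

ωof : ∀ {T} → HasΩ T → Ty T
ωof CDS-hasΩ = ω
ωof BCD-hasΩ = ω

-- Pure λ-terms (de Bruijn indices; terms are up to α-conversion)

data Λ : Set where
  var : ℕ → Λ
  ƛ   : Λ → Λ
  _·_ : Λ → Λ → Λ

infixl 9 _·_

ext : (ℕ → ℕ) → ℕ → ℕ
ext ρ zero    = zero
ext ρ (suc n) = suc (ρ n)

rename : (ℕ → ℕ) → Λ → Λ
rename ρ (var x) = var (ρ x)
rename ρ (ƛ M)   = ƛ (rename (ext ρ) M)
rename ρ (M · N) = rename ρ M · rename ρ N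

exts : (ℕ → Λ) → ℕ → Λ
exts s zero    = var zero
exts s (suc n) = rename suc (s n)

subst : (ℕ → Λ) → Λ → Λ
subst s (var x) = s x
subst s (ƛ M)   = ƛ (subst (exts s) M)
subst s (M · N) = subst s M · subst s N

_[_] : Λ → Λ → Λ
M [ N ] = subst σ M
  where
  σ : ℕ → Λ
  σ zero    = N
  σ (suc n) = var n

infix 4 _⟶[_]_ _≃[_]_
data _⟶[_]_ : Λ → Bool → Λ → Set where
  β    : ∀ {e M N} → (ƛ M) · N ⟶[ e ] (M [ N ])
  η    : ∀ {M} → ƛ (rename suc M · var zero) ⟶[ true ] M
  ξ    : ∀ {e M M'} → M ⟶[ e ] M' → ƛ M ⟶[ e ] ƛ M'
  appˡ : ∀ {e M M' N} → M ⟶[ e ] M' → M · N ⟶[ e ] M' · N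
  appʳ : ∀ {e M N N'} → N ⟶[ e ] N' → M · N ⟶[ e ] M · N'

data _≃[_]_ : Λ → Bool → Λ → Set where
  step  : ∀ {e M N} → M ⟶[ e ] N → M ≃[ e ] N
  ≃refl  : ∀ {e M} → M ≃[ e ] M
  ≃sym   : ∀ {e M N} → M ≃[ e ] N → N ≃[ e ] M
  ≃trans : ∀ {e M N P} → M ≃[ e ] N → N ≃[ e ] P → M ≃[ e ] P

data Rel : Set where
  Syn Beta BetaEta : Rel

⟦_⟧ : Rel → Λ → Λ → Set
⟦ Syn ⟧     M N = M ≡ N
⟦ Beta ⟧    M N = M ≃[ false ] N
⟦ BetaEta ⟧ M N = M ≃[ true ] N

-- Bases: position i of the list gives the declaration of the free
-- variable with de Bruijn index i (nothing = undeclared).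

Basis : Theory → Set
Basis T = List (Maybe (Ty T))

lookupB : ∀ {A : Set} → List (Maybe A) → ℕ → Maybe A
lookupB []       _       = nothing
lookupB (a ∷ B)  zero    = a
lookupB (a ∷ B)  (suc n) = lookupB B n

infix 4 _⊢∩_∶_
data _⊢∩_∶_ {T : Theory} (B : Basis T) : Λ → Ty T → Set where
  ax   : ∀ {x σ} → lookupB B x ≡ just σ → B ⊢∩ var x ∶ σ
  ⇒I   : ∀ {M σ τ} → (just σ ∷ B) ⊢∩ M ∶ τ → B ⊢∩ ƛ M ∶ σ ⇒ τ
  ⇒E   : ∀ {M N σ τ} → B ⊢∩ M ∶ σ ⇒ τ → B ⊢∩ N ∶ σ → B ⊢∩ M · N ∶ τ
  ∩I   : ∀ {M σ τ} → B ⊢∩ M ∶ σ → B ⊢∩ M ∶ τ → B ⊢∩ M ∶ σ ∩ τ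
  ∩E₁  : ∀ {M σ τ} → B ⊢∩ M ∶ σ ∩ τ → B ⊢∩ M ∶ σ
  ∩E₂  : ∀ {M σ τ} → B ⊢∩ M ∶ σ ∩ τ → B ⊢∩ M ∶ τ
  top  : ∀ {M} (h : HasΩ T) → B ⊢∩ M ∶ ωof h
  sub  : ∀ {M σ τ} → B ⊢∩ M ∶ σ → T ⊢ σ ≤ τ → B ⊢∩ M ∶ τ

data DTerm (T : Theory) : Set where
  u    : DTerm T → DTerm T
  var  : ℕ → DTerm T
  lam  : Ty T → DTerm T → DTerm T
  _·_  : DTerm T → DTerm T → DTerm T
  ⟨_,_⟩ : DTerm T → DTerm T → DTerm T
  pr₁  : DTerm T → DTerm T
  pr₂  : DTerm T → DTerm T
  coe  : Ty T → DTerm T → DTerm T      -- Δ^σ  is  coe σ Δ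

⌊_⌋ : ∀ {T} → DTerm T → Λ
⌊ u D ⌋          = ⌊ D ⌋
⌊ var x ⌋        = var x
⌊ lam σ D ⌋      = ƛ ⌊ D ⌋
⌊ D₁ · D₂ ⌋      = ⌊ D₁ ⌋ · ⌊ D₂ ⌋
⌊ ⟨ D₁ , D₂ ⟩ ⌋  = ⌊ D₁ ⌋
⌊ pr₁ D ⌋        = ⌊ D ⌋
⌊ pr₂ D ⌋        = ⌊ D ⌋
⌊ coe σ D ⌋      = ⌊ D ⌋

infix 4 _⊢Δ[_]_∶_
data _⊢Δ[_]_∶_ {T : Theory} (B : Basis T) (R : Rel) : DTerm T → Ty T → Set where
  top  : ∀ {D} (h : HasΩ T) → B ⊢Δ[ R ] u D ∶ ωof h
  ax   : ∀ {x σ} → lookupB B x ≡ just σ → B ⊢Δ[ R ] var x ∶ σ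
  ⇒I   : ∀ {D σ τ} → (just σ ∷ B) ⊢Δ[ R ] D ∶ τ → B ⊢Δ[ R ] lam σ D ∶ σ ⇒ τ
  ⇒E   : ∀ {D₁ D₂ σ τ} → B ⊢Δ[ R ] D₁ ∶ σ ⇒ τ → B ⊢Δ[ R ] D₂ ∶ σ →
         B ⊢Δ[ R ] D₁ · D₂ ∶ τ
  ∩I   : ∀ {D₁ D₂ σ τ} → B ⊢Δ[ R ] D₁ ∶ σ → B ⊢Δ[ R ] D₂ ∶ τ →
         ⟦ R ⟧ ⌊ D₁ ⌋ ⌊ D₂ ⌋ → B ⊢Δ[ R ] ⟨ D₁ , D₂ ⟩ ∶ σ ∩ τ
  ∩E₁  : ∀ {D σ τ} → B ⊢Δ[ R ] D ∶ σ ∩ τ → B ⊢Δ[ R ] pr₁ D ∶ σ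
  ∩E₂  : ∀ {D σ τ} → B ⊢Δ[ R ] D ∶ σ ∩ τ → B ⊢Δ[ R ] pr₂ D ∶ τ
  sub  : ∀ {D σ τ} → B ⊢Δ[ R ] D ∶ σ → T ⊢ σ ≤ τ → B ⊢Δ[ R ] coe τ D ∶ τ

Complete : Theory → Rel → Set
Complete T R = (B : Basis T) (M : Λ) (σ : Ty T) → B ⊢∩ M ∶ σ →
               Σ (DTerm T) (λ D → (M ≡ ⌊ D ⌋) × (B ⊢Δ[ R ] D ∶ σ))

Sound : Theory → Rel → Set
Sound T R = (B : Basis T) (D : DTerm T) (σ : Ty T) → B ⊢Δ[ R ] D ∶ σ →
            B ⊢∩ ⌊ D ⌋ ∶ σ

Unsound : Theory → Rel → Set
Unsound T R = Σ (Basis T) λ B → Σ (DTerm T) λ D → Σ (Ty T) λ σ →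
              (B ⊢Δ[ R ] D ∶ σ) × ¬ (B ⊢∩ ⌊ D ⌋ ∶ σ)

data Considered : Theory → Rel → Set where
  CD-≡   : Considered CD  Syn
  CDV-≡  : Considered CDV Syn
  CDS-≡  : Considered CDS Syn
  BCD-≡  : Considered BCD Syn
  CD-β   : Considered CD  Beta
  CDV-β  : Considered CDV Beta
  CDS-β  : Considered CDS Beta
  BCD-β  : Considered BCD Beta
  CDV-βη : Considered CDV BetaEta
  BCD-βη : Considered BCD BetaEta

-- A λ∩ derivation is read off rule by rule as a Δ-term: (top) becomes u applied to any Δ-term
-- with the right essence and (∩I) a pair of terms with equal essences, so completeness holds for
-- every R. Conversely each rule of Δ erases to the same rule of λ∩ except (∩I), which is sound as
-- soon as λ∩-typings can be transported backwards along R. For ≡ this is trivial; for =β it is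
-- subject reduction plus subject expansion, and typing a redex (λx.M)N from its contractum needs
-- ω for N when x does not occur in M. Without ω, λx.(λy.z)(x x) =β λx.z but only the reduct has
-- type a₂ → a₀, since x : a₂ cannot be applied to itself; with η soundness fails in every theory,
-- since λy.x y =η x while an abstraction never has an atom among its intersection components.
module Submission where

open import Defs
open import Data.Bool using (false)
open import Data.Empty using (⊥; ⊥-elim)
open import Data.List using ([]; _∷_)
open import Data.Maybe using (Maybe; just; nothing)
open import Data.Maybe.Properties using (just-injective)
open import Data.Nat using (ℕ; zero; suc)
open import Data.Product using (Σ; ∃₂; _×_; _,_; proj₁; proj₂)
open import Data.Unit using (⊤; tt)
open import Function using (_⇔_; mk⇔; Equivalence)
import Function.Properties.Equivalence as ⇔
open import Relation.Nullary using (¬_)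
import Relation.Binary.PropositionalEquality as ≡
open ≡ using (_≡_; refl; cong; cong₂)

Arrows : ∀ {w} → (Type w → Type w → Set) → Type w → Set
Arrows F (atom _) = ⊥
Arrows F ω = ⊤
Arrows F (σ ⇒ τ) = F σ τ
Arrows F (σ ∩ τ) = Arrows F σ × Arrows F τ

Ground : ∀ {w} → Type w → Set
Ground (atom _) = ⊤
Ground ω = ⊤
Ground (_ ⇒ _) = ⊥
Ground (σ ∩ τ) = Ground σ × Ground τ

module _ {T : Theory} where

  private variable
    R : Rel
    B Γ Γ₁ Γ₂ : Basis T
    a : Maybe (Ty T)
    M N : Λ
    s : ℕ → Λ
    x n : ℕ
    ρ σ τ σ₁ σ₂ : Ty T
    D : DTerm T

  Ren : Basis T → (ℕ → ℕ) → Basis T → Set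
  Ren Γ r B = ∀ x {σ} → lookupB Γ x ≡ just σ → lookupB B (r x) ≡ just σ

  Ren-ext : ∀ {r} → Ren Γ r B → Ren (a ∷ Γ) (ext r) (a ∷ B)
  Ren-ext h zero e = e
  Ren-ext h (suc x) e = h x e

  ⊢-rename : ∀ {r} → Ren Γ r B → Γ ⊢∩ M ∶ τ → B ⊢∩ rename r M ∶ τ
  ⊢-rename h (ax {x} e) = ax (h x e)
  ⊢-rename h (⇒I d) = ⇒I (⊢-rename (Ren-ext h) d)
  ⊢-rename h (⇒E d₁ d₂) = ⇒E (⊢-rename h d₁) (⊢-rename h d₂)
  ⊢-rename h (∩I d₁ d₂) = ∩I (⊢-rename h d₁) (⊢-rename h d₂)
  ⊢-rename h (∩E₁ d) = ∩E₁ (⊢-rename h d)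
  ⊢-rename h (∩E₂ d) = ∩E₂ (⊢-rename h d)
  ⊢-rename h (top k) = top k
  ⊢-rename h (sub d le) = sub (⊢-rename h d) le

  ⊢-weaken : B ⊢∩ M ∶ τ → (a ∷ B) ⊢∩ rename suc M ∶ τ
  ⊢-weaken = ⊢-rename (λ _ e → e)

  Ren⁻¹ : Basis T → (ℕ → ℕ) → Basis T → Set
  Ren⁻¹ Γ r B = ∀ x {σ} → lookupB B (r x) ≡ just σ → lookupB Γ x ≡ just σ

  Ren⁻¹-ext : ∀ {r} → Ren⁻¹ Γ r B → Ren⁻¹ (a ∷ Γ) (ext r) (a ∷ B)
  Ren⁻¹-ext h zero e = e
  Ren⁻¹-ext h (suc x) e = h x e

  ⊢-unrename : ∀ {r} M → Ren⁻¹ Γ r B → B ⊢∩ rename r M ∶ τ → Γ ⊢∩ M ∶ τ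
  ⊢-unrename (var x) h (ax e) = ax (h x e)
  ⊢-unrename (ƛ M) h (⇒I d) = ⇒I (⊢-unrename M (Ren⁻¹-ext h) d)
  ⊢-unrename (M · N) h (⇒E d₁ d₂) = ⇒E (⊢-unrename M h d₁) (⊢-unrename N h d₂)
  ⊢-unrename M h (∩I d₁ d₂) = ∩I (⊢-unrename M h d₁) (⊢-unrename M h d₂)
  ⊢-unrename M h (∩E₁ d) = ∩E₁ (⊢-unrename M h d)
  ⊢-unrename M h (∩E₂ d) = ∩E₂ (⊢-unrename M h d)
  ⊢-unrename M h (top k) = top k
  ⊢-unrename M h (sub d le) = sub (⊢-unrename M h d) le

  ⊢-unweaken : ∀ M → (a ∷ B) ⊢∩ rename suc M ∶ τ → B ⊢∩ M ∶ τ
  ⊢-unweaken M = ⊢-unrename M (λ _ e → e)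

  Sub : Basis T → (ℕ → Λ) → Basis T → Set
  Sub Γ s B = ∀ x {σ} → lookupB Γ x ≡ just σ → B ⊢∩ s x ∶ σ

  Sub-exts : Sub Γ s B → Sub (just σ ∷ Γ) (exts s) (just σ ∷ B)
  Sub-exts h zero e = ax e
  Sub-exts h (suc x) e = ⊢-weaken (h x e)

  ⊢-subst : Sub Γ s B → Γ ⊢∩ M ∶ τ → B ⊢∩ subst s M ∶ τ
  ⊢-subst h (ax {x} e) = h x e
  ⊢-subst h (⇒I d) = ⇒I (⊢-subst (Sub-exts h) d)
  ⊢-subst h (⇒E d₁ d₂) = ⇒E (⊢-subst h d₁) (⊢-subst h d₂)
  ⊢-subst h (∩I d₁ d₂) = ∩I (⊢-subst h d₁) (⊢-subst h d₂)
  ⊢-subst h (∩E₁ d) = ∩E₁ (⊢-subst h d)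
  ⊢-subst h (∩E₂ d) = ∩E₂ (⊢-subst h d)
  ⊢-subst h (top k) = top k
  ⊢-subst h (sub d le) = sub (⊢-subst h d) le

  subst-cong : ∀ {s s′} → (∀ x → s x ≡ s′ x) → ∀ M → subst s M ≡ subst s′ M
  subst-cong e (var x) = e x
  subst-cong e (ƛ M) = cong ƛ (subst-cong exts-cong M)
    where
    exts-cong : ∀ x → exts _ x ≡ exts _ x
    exts-cong zero = refl
    exts-cong (suc x) = cong (rename suc) (e x)
  subst-cong e (M · N) = cong₂ Λ._·_ (subst-cong e M) (subst-cong e N)

  subst-var : ∀ M → subst var M ≡ M
  subst-var (var x) = refl
  subst-var (ƛ M) = cong ƛ (≡.trans (subst-cong exts-var M) (subst-var M))
    where
    exts-var : ∀ x → exts var x ≡ var x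
    exts-var zero = refl
    exts-var (suc x) = refl
  subst-var (M · N) = cong₂ Λ._·_ (subst-var M) (subst-var N)

  infix 4 _≼_
  _≼_ : Basis T → Basis T → Set
  Γ ≼ B = Sub Γ var B

  ⊢-≼ : Γ ≼ B → Γ ⊢∩ M ∶ τ → B ⊢∩ M ∶ τ
  ⊢-≼ {B = B} {M = M} {τ = τ} h d = ≡.subst (λ L → B ⊢∩ L ∶ τ) (subst-var M) (⊢-subst h d)

  ≼-refl : B ≼ B
  ≼-refl _ e = ax e

  ≼-∷ : (∀ {σ} → a ≡ just σ → (just τ ∷ B) ⊢∩ var zero ∶ σ) → Γ ≼ B → (a ∷ Γ) ≼ (just τ ∷ B)
  ≼-∷ head h zero e = head e
  ≼-∷ head h (suc x) e = ⊢-weaken (h x e)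

  ⊢-narrow : T ⊢ σ₂ ≤ σ₁ → (just σ₁ ∷ B) ⊢∩ M ∶ τ → (just σ₂ ∷ B) ⊢∩ M ∶ τ
  ⊢-narrow le = ⊢-≼ (≼-∷ (λ { refl → sub (ax refl) le }) ≼-refl)

  var-inversion : lookupB B x ≡ just σ → B ⊢∩ var x ∶ τ → T ⊢ σ ≤ τ
  var-inversion e (ax e′) with just-injective (≡.trans (≡.sym e) e′)
  ... | refl = refl
  var-inversion e (∩I d₁ d₂) = glb (var-inversion e d₁) (var-inversion e d₂)
  var-inversion e (∩E₁ d) = trans (var-inversion e d) incl₁
  var-inversion e (∩E₂ d) = trans (var-inversion e d) incl₂
  var-inversion e (top CDS-hasΩ) = ωtop-CDS
  var-inversion e (top BCD-hasΩ) = ωtop-BCD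
  var-inversion e (sub d le) = trans (var-inversion e d) le

  Arrows-mono : {F : Ty T → Ty T → Set} →
                (∀ {σ₁ σ₂ τ₁ τ₂} → T ⊢ σ₂ ≤ σ₁ → T ⊢ τ₁ ≤ τ₂ → F σ₁ τ₁ → F σ₂ τ₂) →
                (∀ {σ τ ρ} → F σ τ → F σ ρ → F σ (τ ∩ ρ)) →
                ((h : HasΩ T) → ∀ {σ} → F σ (ωof h)) →
                T ⊢ σ ≤ τ → Arrows F σ → Arrows F τ
  Arrows-mono {F = F} arrow-mono arrow-∩ arrow-ω = go
    where
    go : T ⊢ σ ≤ τ → Arrows F σ → Arrows F τ
    go refl p = p
    go incl₁ (p , _) = p
    go incl₂ (_ , p) = p
    go (glb le₁ le₂) p = go le₁ p , go le₂ p
    go (trans le₁ le₂) p = go le₂ (go le₁ p)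
    go ωtop-CDS _ = tt
    go ωtop-BCD _ = tt
    go ω⇒-BCD _ = arrow-ω BCD-hasΩ
    go ⇒∩-CDV (p₁ , p₂) = arrow-∩ p₁ p₂
    go ⇒∩-BCD (p₁ , p₂) = arrow-∩ p₁ p₂
    go (arr-CDV le₁ le₂) p = arrow-mono le₁ le₂ p
    go (arr-BCD le₁ le₂) p = arrow-mono le₁ le₂ p

  ƛ-inversion : B ⊢∩ ƛ M ∶ ρ → Arrows (λ σ τ → (just σ ∷ B) ⊢∩ M ∶ τ) ρ
  ƛ-inversion (⇒I d) = d
  ƛ-inversion (∩I d₁ d₂) = ƛ-inversion d₁ , ƛ-inversion d₂
  ƛ-inversion (∩E₁ d) = proj₁ (ƛ-inversion d)
  ƛ-inversion (∩E₂ d) = proj₂ (ƛ-inversion d)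
  ƛ-inversion (top CDS-hasΩ) = tt
  ƛ-inversion (top BCD-hasΩ) = tt
  ƛ-inversion (sub d le) =
    Arrows-mono (λ le₁ le₂ d → sub (⊢-narrow le₁ d) le₂) ∩I (λ h → top h) le (ƛ-inversion d)

  subject-reduction : M ⟶[ false ] N → B ⊢∩ M ∶ τ → B ⊢∩ N ∶ τ
  subject-reduction r (∩I d₁ d₂) = ∩I (subject-reduction r d₁) (subject-reduction r d₂)
  subject-reduction r (∩E₁ d) = ∩E₁ (subject-reduction r d)
  subject-reduction r (∩E₂ d) = ∩E₂ (subject-reduction r d)
  subject-reduction r (top h) = top h
  subject-reduction r (sub d le) = sub (subject-reduction r d) le
  subject-reduction β (⇒E d₁ d₂) =
    ⊢-subst (λ { zero refl → d₂ ; (suc x) e → ax e }) (ƛ-inversion d₁)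
  subject-reduction (ξ r) (⇒I d) = ⇒I (subject-reduction r d)
  subject-reduction (appˡ r) (⇒E d₁ d₂) = ⇒E (subject-reduction r d₁) d₂
  subject-reduction (appʳ r) (⇒E d₁ d₂) = ⇒E d₁ (subject-reduction r d₂)

  _⊓ᵈ_ : Maybe (Ty T) → Maybe (Ty T) → Maybe (Ty T)
  nothing ⊓ᵈ b = b
  just σ ⊓ᵈ nothing = just σ
  just σ ⊓ᵈ just τ = just (σ ∩ τ)

  _⊓_ : Basis T → Basis T → Basis T
  [] ⊓ Γ₂ = Γ₂
  (a ∷ Γ₁) ⊓ [] = a ∷ Γ₁
  (a ∷ Γ₁) ⊓ (b ∷ Γ₂) = (a ⊓ᵈ b) ∷ (Γ₁ ⊓ Γ₂)

  ⊓ᵈ-nothing : ∀ a → a ⊓ᵈ nothing ≡ a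
  ⊓ᵈ-nothing nothing = refl
  ⊓ᵈ-nothing (just σ) = refl

  lookup-⊓ : ∀ Γ₁ Γ₂ x → lookupB (Γ₁ ⊓ Γ₂) x ≡ lookupB Γ₁ x ⊓ᵈ lookupB Γ₂ x
  lookup-⊓ [] Γ₂ x = refl
  lookup-⊓ (a ∷ Γ₁) [] x = ≡.sym (⊓ᵈ-nothing (lookupB (a ∷ Γ₁) x))
  lookup-⊓ (a ∷ Γ₁) (b ∷ Γ₂) zero = refl
  lookup-⊓ (a ∷ Γ₁) (b ∷ Γ₂) (suc x) = lookup-⊓ Γ₁ Γ₂ x

  ⊓-≼ˡ : ∀ Γ₁ Γ₂ → Γ₁ ≼ (Γ₁ ⊓ Γ₂)
  ⊓-≼ˡ Γ₁ Γ₂ x e = var-⊓ (lookupB Γ₂ x) (≡.trans (lookup-⊓ Γ₁ Γ₂ x) (cong (_⊓ᵈ lookupB Γ₂ x) e))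
    where
    var-⊓ : ∀ b → lookupB (Γ₁ ⊓ Γ₂) x ≡ just σ ⊓ᵈ b → (Γ₁ ⊓ Γ₂) ⊢∩ var x ∶ σ
    var-⊓ nothing e = ax e
    var-⊓ (just τ) e = ∩E₁ (ax e)

  ⊓-≼ʳ : ∀ Γ₁ Γ₂ → Γ₂ ≼ (Γ₁ ⊓ Γ₂)
  ⊓-≼ʳ Γ₁ Γ₂ x e = var-⊓ (lookupB Γ₁ x) (≡.trans (lookup-⊓ Γ₁ Γ₂ x) (cong (lookupB Γ₁ x ⊓ᵈ_) e))
    where
    var-⊓ : ∀ b → lookupB (Γ₁ ⊓ Γ₂) x ≡ b ⊓ᵈ just σ → (Γ₁ ⊓ Γ₂) ⊢∩ var x ∶ σ
    var-⊓ nothing e = ax e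
    var-⊓ (just τ) e = ∩E₂ (ax e)

  Sub-⊓ : ∀ Γ₁ Γ₂ → Sub Γ₁ s B → Sub Γ₂ s B → Sub (Γ₁ ⊓ Γ₂) s B
  Sub-⊓ [] Γ₂ h₁ h₂ = h₂
  Sub-⊓ (a ∷ Γ₁) [] h₁ h₂ = h₁
  Sub-⊓ (nothing ∷ Γ₁) (b ∷ Γ₂) h₁ h₂ zero e = h₂ zero e
  Sub-⊓ (just σ ∷ Γ₁) (nothing ∷ Γ₂) h₁ h₂ zero e = h₁ zero e
  Sub-⊓ (just σ ∷ Γ₁) (just τ ∷ Γ₂) h₁ h₂ zero refl = ∩I (h₁ zero refl) (h₂ zero refl)
  Sub-⊓ (a ∷ Γ₁) (b ∷ Γ₂) h₁ h₂ (suc x) e = Sub-⊓ Γ₁ Γ₂ (λ y → h₁ (suc y)) (λ y → h₂ (suc y)) x e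

  singleton : ℕ → Ty T → Basis T
  singleton zero σ = just σ ∷ []
  singleton (suc x) σ = nothing ∷ singleton x σ

  lookup-singleton : ∀ x → lookupB (singleton x σ) x ≡ just σ
  lookup-singleton zero = refl
  lookup-singleton (suc x) = lookup-singleton x

  Sub-singleton : ∀ x → B ⊢∩ s x ∶ σ → Sub (singleton x σ) s B
  Sub-singleton zero d zero refl = d
  Sub-singleton {s = s} (suc x) d (suc y) e = Sub-singleton {s = λ z → s (suc z)} x d y e

  SubstPreimage : Λ → (ℕ → Λ) → Basis T → Ty T → Set
  SubstPreimage M s B τ = Σ (Basis T) λ Γ → (Γ ⊢∩ M ∶ τ) × Sub Γ s B

  preimage-mono : T ⊢ σ ≤ τ → SubstPreimage M s B σ → SubstPreimage M s B τ
  preimage-mono le (Γ , d , h) = Γ , sub d le , h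

  preimage-merge : ∀ {M₁ M₂} →
                   (∀ {Γ} → Γ ⊢∩ M₁ ∶ σ₁ → Γ ⊢∩ M₂ ∶ σ₂ → Γ ⊢∩ M ∶ τ) →
                   SubstPreimage M₁ s B σ₁ → SubstPreimage M₂ s B σ₂ → SubstPreimage M s B τ
  preimage-merge rule (Γ₁ , d₁ , h₁) (Γ₂ , d₂ , h₂) =
    Γ₁ ⊓ Γ₂ , rule (⊢-≼ (⊓-≼ˡ Γ₁ Γ₂) d₁) (⊢-≼ (⊓-≼ʳ Γ₁ Γ₂) d₂) , Sub-⊓ Γ₁ Γ₂ h₁ h₂

  preimage-ƛ : SubstPreimage M (exts s) (just σ ∷ B) τ → SubstPreimage (ƛ M) s B (σ ⇒ τ)
  preimage-ƛ ([] , d , h) = [] , ⇒I (⊢-≼ (λ _ ()) d) , λ _ ()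
  preimage-ƛ {s = s} {σ = σ} ((a ∷ Γ) , d , h) =
    Γ , ⇒I (⊢-≼ (≼-∷ bound ≼-refl) d) , λ x e → ⊢-unweaken (s x) (h (suc x) e)
    where
    bound : a ≡ just ρ → (just σ ∷ Γ) ⊢∩ var zero ∶ ρ
    bound e = sub (ax refl) (var-inversion refl (h zero e))

  subst-preimage : ∀ M → B ⊢∩ subst s M ∶ τ → SubstPreimage M s B τ
  subst-preimage (var x) d = singleton x _ , ax (lookup-singleton x) , Sub-singleton x d
  subst-preimage (ƛ M) (⇒I d) = preimage-ƛ (subst-preimage M d)
  subst-preimage (M · N) (⇒E d₁ d₂) = preimage-merge ⇒E (subst-preimage M d₁) (subst-preimage N d₂)
  subst-preimage M (∩I d₁ d₂) = preimage-merge ∩I (subst-preimage M d₁) (subst-preimage M d₂)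
  subst-preimage M (∩E₁ d) = preimage-mono incl₁ (subst-preimage M d)
  subst-preimage M (∩E₂ d) = preimage-mono incl₂ (subst-preimage M d)
  subst-preimage M (top h) = [] , top h , λ _ ()
  subst-preimage M (sub d le) = preimage-mono le (subst-preimage M d)

  Sub-tail-≼ : (∀ x → s (suc x) ≡ var x) → Sub (a ∷ Γ) s B → Γ ≼ B
  Sub-tail-≼ {B = B} s-suc h x e = ≡.subst (λ L → B ⊢∩ L ∶ _) (s-suc x) (h (suc x) e)

  -- The argument N is given the type at which the substituted variable is used, or ω if unused.
  redex-typing : HasΩ T → s zero ≡ N → (∀ x → s (suc x) ≡ var x) →
                 SubstPreimage M s B τ → B ⊢∩ (ƛ M) · N ∶ τ
  redex-typing ω∈T refl s-suc ([] , d , h) = ⇒E (⇒I (⊢-≼ (λ _ ()) d)) (top ω∈T)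
  redex-typing ω∈T refl s-suc ((nothing ∷ Γ) , d , h) =
    ⇒E (⇒I (⊢-≼ (≼-∷ (λ ()) (Sub-tail-≼ s-suc h)) d)) (top ω∈T)
  redex-typing ω∈T refl s-suc ((just σ ∷ Γ) , d , h) =
    ⇒E (⇒I (⊢-≼ (≼-∷ (λ { refl → ax refl }) (Sub-tail-≼ s-suc h)) d)) (h zero refl)

  β-expansion : HasΩ T → B ⊢∩ M [ N ] ∶ τ → B ⊢∩ (ƛ M) · N ∶ τ
  β-expansion {M = M} ω∈T d = redex-typing ω∈T refl (λ _ → refl) (subst-preimage M d)

  subject-expansion : HasΩ T → M ⟶[ false ] N → B ⊢∩ N ∶ τ → B ⊢∩ M ∶ τ
  subject-expansion ω∈T β d = β-expansion ω∈T d
  subject-expansion ω∈T r (∩I d₁ d₂) = ∩I (subject-expansion ω∈T r d₁) (subject-expansion ω∈T r d₂)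
  subject-expansion ω∈T r (∩E₁ d) = ∩E₁ (subject-expansion ω∈T r d)
  subject-expansion ω∈T r (∩E₂ d) = ∩E₂ (subject-expansion ω∈T r d)
  subject-expansion ω∈T r (top h) = top h
  subject-expansion ω∈T r (sub d le) = sub (subject-expansion ω∈T r d) le
  subject-expansion ω∈T (ξ r) (⇒I d) = ⇒I (subject-expansion ω∈T r d)
  subject-expansion ω∈T (appˡ r) (⇒E d₁ d₂) = ⇒E (subject-expansion ω∈T r d₁) d₂
  subject-expansion ω∈T (appʳ r) (⇒E d₁ d₂) = ⇒E d₁ (subject-expansion ω∈T r d₂)

  ⊢-≃β : HasΩ T → M ≃[ false ] N → (B ⊢∩ M ∶ τ) ⇔ (B ⊢∩ N ∶ τ)
  ⊢-≃β ω∈T (step r) = mk⇔ (subject-reduction r) (subject-expansion ω∈T r)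
  ⊢-≃β ω∈T ≃refl = ⇔.refl
  ⊢-≃β ω∈T (≃sym c) = ⇔.sym (⊢-≃β ω∈T c)
  ⊢-≃β ω∈T (≃trans c₁ c₂) = ⇔.trans (⊢-≃β ω∈T c₁) (⊢-≃β ω∈T c₂)

  Expansive : Rel → Set
  Expansive R = ∀ {B : Basis T} {M N τ} → ⟦ R ⟧ M N → B ⊢∩ N ∶ τ → B ⊢∩ M ∶ τ

  Syn-expansive : Expansive Syn
  Syn-expansive refl d = d

  Beta-expansive : HasΩ T → Expansive Beta
  Beta-expansive ω∈T c = Equivalence.from (⊢-≃β ω∈T c)

  expansive⇒sound : Expansive R → Sound T R
  expansive⇒sound {R = R} expand _ _ _ = go
    where
    go : B ⊢Δ[ R ] D ∶ σ → B ⊢∩ ⌊ D ⌋ ∶ σ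
    go (top h) = top h
    go (ax e) = ax e
    go (⇒I d) = ⇒I (go d)
    go (⇒E d₁ d₂) = ⇒E (go d₁) (go d₂)
    go (∩I d₁ d₂ c) = ∩I (go d₁) (expand c (go d₂))
    go (∩E₁ d) = ∩E₁ (go d)
    go (∩E₂ d) = ∩E₂ (go d)
    go (sub d le) = sub (go d) le

  -- The binder annotations are arbitrary: ⌈ M ⌉ only occurs under u, which is never inspected.
  ⌈_⌉ : Λ → DTerm T
  ⌈ var x ⌉ = var x
  ⌈ ƛ M ⌉ = lam (atom 0) ⌈ M ⌉
  ⌈ M · N ⌉ = ⌈ M ⌉ · ⌈ N ⌉

  ⌊⌈_⌉⌋ : ∀ M → M ≡ ⌊ ⌈ M ⌉ ⌋
  ⌊⌈ var x ⌉⌋ = refl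
  ⌊⌈ ƛ M ⌉⌋ = cong ƛ ⌊⌈ M ⌉⌋
  ⌊⌈ M · N ⌉⌋ = cong₂ Λ._·_ ⌊⌈ M ⌉⌋ ⌊⌈ N ⌉⌋

  ⟦⟧-reflexive : ∀ R → M ≡ N → ⟦ R ⟧ M N
  ⟦⟧-reflexive Syn e = e
  ⟦⟧-reflexive Beta refl = ≃refl
  ⟦⟧-reflexive BetaEta refl = ≃refl

  complete : Complete T R
  complete {R = R} _ _ _ = go
    where
    go : B ⊢∩ M ∶ σ → Σ (DTerm T) λ D → (M ≡ ⌊ D ⌋) × (B ⊢Δ[ R ] D ∶ σ)
    go (ax {x} e) = var x , refl , ax e
    go (⇒I {σ = σ} d) with go d
    ... | D , refl , t = lam σ D , refl , ⇒I t
    go (⇒E d₁ d₂) with go d₁ | go d₂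
    ... | D₁ , refl , t₁ | D₂ , refl , t₂ = D₁ · D₂ , refl , ⇒E t₁ t₂
    go (∩I d₁ d₂) with go d₁ | go d₂
    ... | D₁ , refl , t₁ | D₂ , e , t₂ = ⟨ D₁ , D₂ ⟩ , refl , ∩I t₁ t₂ (⟦⟧-reflexive R e)
    go (∩E₁ d) with go d
    ... | D , refl , t = pr₁ D , refl , ∩E₁ t
    go (∩E₂ d) with go d
    ... | D , refl , t = pr₂ D , refl , ∩E₂ t
    go (top {M} h) = u ⌈ M ⌉ , ⌊⌈ M ⌉⌋ , top h
    go (sub {τ = τ} d le) with go d
    ... | D , refl , t = coe τ D , refl , sub t le

  Ground-mono : (HasΩ T → ⊥) → T ⊢ σ ≤ τ → Ground σ → Ground τ
  Ground-mono noω refl p = p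
  Ground-mono noω incl₁ (p , _) = p
  Ground-mono noω incl₂ (_ , p) = p
  Ground-mono noω (glb le₁ le₂) p = Ground-mono noω le₁ p , Ground-mono noω le₂ p
  Ground-mono noω (trans le₁ le₂) p = Ground-mono noω le₂ (Ground-mono noω le₁ p)
  Ground-mono noω ωtop-CDS _ = ⊥-elim (noω CDS-hasΩ)
  Ground-mono noω ωtop-BCD _ = ⊥-elim (noω BCD-hasΩ)
  Ground-mono noω ω⇒-BCD _ = ⊥-elim (noω BCD-hasΩ)
  Ground-mono noω ⇒∩-CDV (() , _)
  Ground-mono noω ⇒∩-BCD (() , _)
  Ground-mono noω (arr-CDV _ _) ()
  Ground-mono noω (arr-BCD _ _) ()

  atom≰⇒ : (HasΩ T → ⊥) → ¬ (T ⊢ atom n ≤ σ ⇒ τ)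
  atom≰⇒ noω le = Ground-mono noω le tt

  ·-inversion : (HasΩ T → ⊥) → B ⊢∩ M · N ∶ ρ →
                ∃₂ λ σ τ → (B ⊢∩ M ∶ σ ⇒ τ) × (B ⊢∩ N ∶ σ)
  ·-inversion noω (⇒E d₁ d₂) = _ , _ , d₁ , d₂
  ·-inversion noω (∩I d _) = ·-inversion noω d
  ·-inversion noω (∩E₁ d) = ·-inversion noω d
  ·-inversion noω (∩E₂ d) = ·-inversion noω d
  ·-inversion noω (top h) = ⊥-elim (noω h)
  ·-inversion noω (sub d _) = ·-inversion noω d

  atom-self-application : (HasΩ T → ⊥) → lookupB B x ≡ just (atom n) → ¬ (B ⊢∩ var x · var x ∶ ρ)
  atom-self-application noω e d with ·-inversion noω d
  ... | _ , _ , ⊢x , _ = atom≰⇒ noω (var-inversion e ⊢x)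

  -- ⌊ D ⌋ = λx.(λy.z)(x x) =β λx.z with z : a₀.
  unsound-β : (HasΩ T → ⊥) → Unsound T Beta
  unsound-β noω = just (atom 0) ∷ [] , ⟨ D₁ , D₂ ⟩ , π , ∩I ⊢D₁ ⊢D₂ (step (ξ β)) , untypable
    where
    α : Ty T
    α = atom 1 ∩ (atom 1 ⇒ atom 1)
    D₁ D₂ : DTerm T
    D₁ = lam α (lam (atom 1) (var 2) · (pr₂ (var 0) · pr₁ (var 0)))
    D₂ = lam (atom 2) (var 1)
    π : Ty T
    π = (α ⇒ atom 0) ∩ (atom 2 ⇒ atom 0)
    ⊢D₁ : (just (atom 0) ∷ []) ⊢Δ[ Beta ] D₁ ∶ α ⇒ atom 0
    ⊢D₁ = ⇒I (⇒E (⇒I (ax refl)) (⇒E (∩E₂ (ax refl)) (∩E₁ (ax refl))))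
    ⊢D₂ : (just (atom 0) ∷ []) ⊢Δ[ Beta ] D₂ ∶ atom 2 ⇒ atom 0
    ⊢D₂ = ⇒I (ax refl)
    untypable : ¬ ((just (atom 0) ∷ []) ⊢∩ ⌊ ⟨ D₁ , D₂ ⟩ ⌋ ∶ π)
    untypable d with ·-inversion noω (proj₂ (ƛ-inversion d))
    ... | _ , _ , _ , ⊢xx = atom-self-application noω refl ⊢xx

  -- ⌊ D ⌋ = λy.x y =η x with x : a₀ ∩ (a₁ → a₂).
  unsound-η : Unsound T BetaEta
  unsound-η =
    just (atom 0 ∩ (atom 1 ⇒ atom 2)) ∷ [] ,
    ⟨ lam (atom 1) (pr₂ (var 1) · var 0) , pr₁ (var 0) ⟩ ,
    (atom 1 ⇒ atom 2) ∩ atom 0 ,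
    ∩I (⇒I (⇒E (∩E₂ (ax refl)) (ax refl))) (∩E₁ (ax refl)) (step η) ,
    λ d → proj₂ (ƛ-inversion d)

theorem5p2 : ((T : Theory) (R : Rel) → Considered T R → Complete T R)
           × (Sound CD Syn × Sound CDV Syn × Sound CDS Syn × Sound BCD Syn
              × Sound CDS Beta × Sound BCD Beta)
           × (Unsound CD Beta × Unsound CDV Beta × Unsound CDV BetaEta
              × Unsound BCD BetaEta)
theorem5p2 =
  (λ T R _ → complete {T = T} {R = R}) ,
  (syn-sound , syn-sound , syn-sound , syn-sound ,
   expansive⇒sound (Beta-expansive CDS-hasΩ) , expansive⇒sound (Beta-expansive BCD-hasΩ)) ,
  (unsound-β (λ ()) , unsound-β (λ ()) , unsound-η , unsound-η)
  where
  syn-sound : ∀ {T} → Sound T Syn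
  syn-sound = expansive⇒sound Syn-expansive
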